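{- The coefficient of $q^N$ in $H_{5,3,5}(q)$ is nonnegative for every integer $N \ge 164$.
   Context: $(a;q)_n := (1-a)(1-aq)\cdots(1-aq^{n-1})$. For positive integers $L,s,k$, $H_{L,s,k}(q) := \frac{q^s(1-q^k)}{(q^s;q)_{L+1}} - \left(\frac{1}{(q^{s+1};q)_L}-1\right)$. -}

module Defs where

open import Data.Nat as ℕ using (ℕ; zero; suc; _∸_)
open import Data.Nat.Divisibility using (_∣?_)
open import Data.Integer using (ℤ; +_; _+_; _-_; _*_; 0ℤ; 1ℤ)
open import Relation.Nullary.Decidable using (does)
open import Data.Bool using (if_then_else_)

-- Formal power series in q with integer coefficients: n ↦ coefficient of q^n.
Series : Set
Series = ℕ → ℤ

sumTo : ℕ → (ℕ → ℤ) → ℤ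
sumTo zero    f = f 0
sumTo (suc n) f = sumTo n f + f (suc n)

_⊛_ : Series → Series → Series
(f ⊛ g) n = sumTo n (λ i → f i * g (n ∸ i))

_⊕_ : Series → Series → Series
(f ⊕ g) n = f n + g n

_⊖_ : Series → Series → Series
(f ⊖ g) n = f n - g n

qpow : ℕ → Series
qpow k n = if does (n ℕ.≟ k) then 1ℤ else 0ℤ

oneS : Series
oneS = qpow 0

-- 1/(1 - q^k) = Σ_{m ≥ 0} q^{k m}   (used only for k ≥ 1)
geom : ℕ → Series
geom k n = if does (k ∣? n) then 1ℤ else 0ℤ

-- 1/(a;q)_m with a = q^s:  ∏_{i=0}^{m-1} 1/(1 - q^{s+i})
invPoch : ℕ → ℕ → Series
invPoch s zero    = oneS
invPoch s (suc m) = invPoch s m ⊛ geom (s ℕ.+ m)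

-- H_{L,s,k}(q) = q^s (1 - q^k) / (q^s;q)_{L+1} - (1/(q^{s+1};q)_L - 1)
H : ℕ → ℕ → ℕ → Series
H L s k = ((qpow s ⊛ (oneS ⊖ qpow k)) ⊛ invPoch s (suc L))
          ⊖ (invPoch (suc s) L ⊖ oneS)

{-# OPTIONS --safe #-}
-- Cancelling the factor 1 - q⁵ gives H₅,₃,₅ = 1 + u·W with u = q³/(1 - q³) - 1/(1 - q⁵) and
-- W = 1/((1 - q⁴)(1 - q⁶)(1 - q⁷)(1 - q⁸)). Away from q⁰ the coefficients of u are 15-periodic,
-- and as 4 is invertible modulo 15, the coefficients of u/(1 - q⁴) grow every 60 steps by a
-- full period of u, whose sum is 5 - 3 ≥ 0. So u/(1 - q⁴) is nonnegative from q⁴⁰ on once one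
-- window of 60 coefficients is checked, and each further factor 1/(1 - qᵏ) preserves this
-- after checking k more coefficients. All checks are finite evaluations, and in fact give
-- nonnegativity for every N ≥ 40.
module Submission where

open import Defs
open import Algebra.Bundles using (CommutativeMonoid)
open import Data.Bool using (if_then_else_)
open import Data.Integer using (ℤ; 0ℤ; 1ℤ; _+_; _-_; _*_) renaming (_≤_ to _≤ℤ_)
import Data.Integer.Properties as ℤ
open import Data.Integer.Tactic.RingSolver using (solve-∀)
open import Data.Nat as ℕ using (ℕ; zero; suc; _∸_; _≤_; _<_; z≤n; s≤s; NonZero)
open import Data.Nat.Divisibility using (_∣_; _∣?_; _∣0; ∣m+n∣m⇒∣n; ∣m∣n⇒∣m+n; ∣-refl; >⇒∤)
open import Data.Nat.Induction using (<-rec)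
open import Data.Nat.Properties as ℕ
  using ( ≤-refl; ≤-trans; m≤m+n; m≤n+m; m<m+n; m+n∸n≡m; m∸n+n≡m; m+[n∸m]≡n; ≮⇒≥
        ; _<?_; _≤?_; allUpTo?)
import Data.Nat.Tactic.RingSolver as ℕ-Solver
open import Data.Product using (_,_)
open import Data.Sum using (inj₁; inj₂)
open import Function.Bundles using (mk⇔)
open import Relation.Binary.Bundles using (Setoid)
open import Relation.Binary.PropositionalEquality
import Relation.Binary.Reasoning.Setoid as SetoidReasoning
open import Relation.Nullary using (yes; no)
open import Relation.Nullary.Decidable using (does-⇔; dec-true; dec-false; True; toWitness)

sumTo-cong : ∀ n {f g : ℕ → ℤ} → (∀ {i} → i ≤ n → f i ≡ g i) → sumTo n f ≡ sumTo n g
sumTo-cong zero    f≡g = f≡g z≤n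
sumTo-cong (suc n) f≡g = cong₂ _+_ (sumTo-cong n (λ i≤n → f≡g (ℕ.m≤n⇒m≤1+n i≤n))) (f≡g ≤-refl)

sumTo-distrib-+ : ∀ n (f g : ℕ → ℤ) → sumTo n (λ i → f i + g i) ≡ sumTo n f + sumTo n g
sumTo-distrib-+ zero    f g = refl
sumTo-distrib-+ (suc n) f g rewrite sumTo-distrib-+ n f g =
  medial (sumTo n f) (sumTo n g) (f (suc n)) (g (suc n))
  where medial : ∀ a b c d → (a + b) + (c + d) ≡ (a + c) + (b + d)
        medial = solve-∀

sumTo-distrib-- : ∀ n (f g : ℕ → ℤ) → sumTo n (λ i → f i - g i) ≡ sumTo n f - sumTo n g
sumTo-distrib-- zero    f g = refl
sumTo-distrib-- (suc n) f g rewrite sumTo-distrib-- n f g =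
  medial (sumTo n f) (sumTo n g) (f (suc n)) (g (suc n))
  where medial : ∀ a b c d → (a - b) + (c - d) ≡ (a + c) - (b + d)
        medial = solve-∀

*-distribˡ-sumTo : ∀ n c (f : ℕ → ℤ) → c * sumTo n f ≡ sumTo n (λ i → c * f i)
*-distribˡ-sumTo zero    c f = refl
*-distribˡ-sumTo (suc n) c f =
  trans (ℤ.*-distribˡ-+ c (sumTo n f) (f (suc n))) (cong (_+ c * f (suc n)) (*-distribˡ-sumTo n c f))

*-distribʳ-sumTo : ∀ n c (f : ℕ → ℤ) → sumTo n f * c ≡ sumTo n (λ i → f i * c)
*-distribʳ-sumTo zero    c f = refl
*-distribʳ-sumTo (suc n) c f =
  trans (ℤ.*-distribʳ-+ c (sumTo n f) (f (suc n))) (cong (_+ f (suc n) * c) (*-distribʳ-sumTo n c f))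

sumTo-suc : ∀ n (f : ℕ → ℤ) → sumTo (suc n) f ≡ f 0 + sumTo n (λ i → f (suc i))
sumTo-suc zero    f = refl
sumTo-suc (suc n) f rewrite sumTo-suc n f = ℤ.+-assoc (f 0) _ _

sumTo-reverse : ∀ n (f : ℕ → ℤ) → sumTo n f ≡ sumTo n (λ i → f (n ∸ i))
sumTo-reverse zero    f = refl
sumTo-reverse (suc n) f = begin
  sumTo n f + f (suc n)                 ≡⟨ cong (_+ f (suc n)) (sumTo-reverse n f) ⟩
  sumTo n (λ i → f (n ∸ i)) + f (suc n) ≡⟨ ℤ.+-comm _ (f (suc n)) ⟩
  f (suc n) + sumTo n (λ i → f (n ∸ i)) ≡⟨ sumTo-suc n (λ i → f (suc n ∸ i)) ⟨
  sumTo (suc n) (λ i → f (suc n ∸ i))   ∎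
  where open ≡-Reasoning

sumTo-triangle : ∀ m (A : ℕ → ℕ → ℤ) →
  sumTo m (λ k → sumTo k (λ i → A i k)) ≡ sumTo m (λ i → sumTo (m ∸ i) (λ j → A i (i ℕ.+ j)))
sumTo-triangle zero    A = refl
sumTo-triangle (suc m) A = begin
  sumTo m (λ k → sumTo k (λ i → A i k)) + (sumTo m (λ i → A i (suc m)) + A (suc m) (suc m))
    ≡⟨ cong (_+ (sumTo m (λ i → A i (suc m)) + A (suc m) (suc m))) (sumTo-triangle m A) ⟩
  Row m + (sumTo m (λ i → A i (suc m)) + A (suc m) (suc m))
    ≡⟨ ℤ.+-assoc (Row m) _ _ ⟨
  (Row m + sumTo m (λ i → A i (suc m))) + A (suc m) (suc m)
    ≡⟨ cong (_+ A (suc m) (suc m)) (sumTo-distrib-+ m _ _) ⟨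
  sumTo m (λ i → sumTo (m ∸ i) (λ j → A i (i ℕ.+ j)) + A i (suc m)) + A (suc m) (suc m)
    ≡⟨ cong₂ _+_ (sumTo-cong m extend) diagonal ⟩
  Row (suc m) ∎
  where
  open ≡-Reasoning
  Row : ℕ → ℤ
  Row m = sumTo m (λ i → sumTo (m ∸ i) (λ j → A i (i ℕ.+ j)))
  extend : ∀ {i} → i ≤ m → sumTo (m ∸ i) (λ j → A i (i ℕ.+ j)) + A i (suc m)
                         ≡ sumTo (suc m ∸ i) (λ j → A i (i ℕ.+ j))
  extend {i} i≤m rewrite ℕ.+-∸-assoc 1 i≤m =
    cong (λ k → sumTo (m ∸ i) (λ j → A i (i ℕ.+ j)) + A i k)
         (sym (trans (ℕ.+-suc i (m ∸ i)) (cong suc (m+[n∸m]≡n i≤m))))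
  diagonal : A (suc m) (suc m) ≡ sumTo (m ∸ m) (λ j → A (suc m) (suc m ℕ.+ j))
  diagonal rewrite ℕ.n∸n≡0 m | ℕ.+-identityʳ m = refl

qpow-≢ : ∀ {k i} → i ≢ k → qpow k i ≡ 0ℤ
qpow-≢ {k} {i} i≢k = cong (if_then 1ℤ else 0ℤ) (dec-false (i ℕ.≟ k) i≢k)

qpow-≡ : ∀ k → qpow k k ≡ 1ℤ
qpow-≡ k = cong (if_then 1ℤ else 0ℤ) (dec-true (k ℕ.≟ k) refl)

oneS-pos : ∀ {m} → 0 < m → oneS m ≡ 0ℤ
oneS-pos 0<m = qpow-≢ (ℕ.>⇒≢ 0<m)

sumTo-qpow-< : ∀ {k m} (h : ℕ → ℤ) → m < k → sumTo m (λ i → qpow k i * h i) ≡ 0ℤ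
sumTo-qpow-< {k} {zero}  h 0<k rewrite qpow-≢ {k} {0} (ℕ.<⇒≢ 0<k) = refl
sumTo-qpow-< {k} {suc m} h m<k
  rewrite sumTo-qpow-< {k} {m} h (ℕ.<-trans (ℕ.n<1+n m) m<k) | qpow-≢ {k} {suc m} (ℕ.<⇒≢ m<k) = refl

sumTo-qpow-≤ : ∀ {k m} (h : ℕ → ℤ) → k ≤ m → sumTo m (λ i → qpow k i * h i) ≡ h k
sumTo-qpow-≤ {k} {m} h k≤m with ℕ.m≤n⇒m<n∨m≡n k≤m
sumTo-qpow-≤ {zero}  {zero}   h _ | inj₂ refl = ℤ.*-identityˡ (h 0)
sumTo-qpow-≤ {suc k} {.suc k} h _ | inj₂ refl
  rewrite sumTo-qpow-< {suc k} {k} h (ℕ.n<1+n k) | qpow-≡ (suc k) =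
  trans (ℤ.+-identityˡ _) (ℤ.*-identityˡ (h (suc k)))
sumTo-qpow-≤ {k}     {suc m}  h _ | inj₁ k<1+m
  rewrite sumTo-qpow-≤ {k} {m} h (ℕ.m<1+n⇒m≤n k<1+m) | qpow-≢ {k} {suc m} (ℕ.>⇒≢ k<1+m) = ℤ.+-identityʳ (h k)

qpow-⊛-< : ∀ {k m} (f : Series) → m < k → (qpow k ⊛ f) m ≡ 0ℤ
qpow-⊛-< f = sumTo-qpow-< _

qpow-⊛-+ : ∀ k (f : Series) j → (qpow k ⊛ f) (j ℕ.+ k) ≡ f j
qpow-⊛-+ k f j = trans (sumTo-qpow-≤ _ (m≤n+m k j)) (cong f (m+n∸n≡m j k))

⊛-cong : ∀ {f f′ g g′} → f ≗ f′ → g ≗ g′ → (f ⊛ g) ≗ (f′ ⊛ g′)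
⊛-cong f≗f′ g≗g′ n = sumTo-cong n (λ {i} _ → cong₂ _*_ (f≗f′ i) (g≗g′ (n ∸ i)))

⊛-congˡ : ∀ {f f′} g → f ≗ f′ → (f ⊛ g) ≗ (f′ ⊛ g)
⊛-congˡ g f≗f′ = ⊛-cong {g = g} f≗f′ (λ _ → refl)

⊛-congʳ : ∀ f {g g′} → g ≗ g′ → (f ⊛ g) ≗ (f ⊛ g′)
⊛-congʳ f g≗g′ = ⊛-cong {f} (λ _ → refl) g≗g′

⊛-comm : ∀ f g → (f ⊛ g) ≗ (g ⊛ f)
⊛-comm f g n = trans (sumTo-reverse n _) (sumTo-cong n λ {i} i≤n →
  trans (cong (λ j → f (n ∸ i) * g j) (ℕ.m∸[m∸n]≡n i≤n)) (ℤ.*-comm (f (n ∸ i)) (g i)))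

⊛-assoc : ∀ f g h → ((f ⊛ g) ⊛ h) ≗ (f ⊛ (g ⊛ h))
⊛-assoc f g h n = begin
  sumTo n (λ k → sumTo k (λ i → f i * g (k ∸ i)) * h (n ∸ k))
    ≡⟨ sumTo-cong n (λ {k} _ → *-distribʳ-sumTo k (h (n ∸ k)) _) ⟩
  sumTo n (λ k → sumTo k (λ i → f i * g (k ∸ i) * h (n ∸ k)))
    ≡⟨ sumTo-triangle n (λ i k → f i * g (k ∸ i) * h (n ∸ k)) ⟩
  sumTo n (λ i → sumTo (n ∸ i) (λ j → f i * g (i ℕ.+ j ∸ i) * h (n ∸ (i ℕ.+ j))))
    ≡⟨ sumTo-cong n (λ {i} _ → trans (sumTo-cong (n ∸ i) (λ {j} _ → reindex i j))
                                     (sym (*-distribˡ-sumTo (n ∸ i) (f i) _))) ⟩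
  sumTo n (λ i → f i * sumTo (n ∸ i) (λ j → g j * h (n ∸ i ∸ j))) ∎
  where
  open ≡-Reasoning
  reindex : ∀ i j → f i * g (i ℕ.+ j ∸ i) * h (n ∸ (i ℕ.+ j)) ≡ f i * (g j * h (n ∸ i ∸ j))
  reindex i j rewrite ℕ.m+n∸m≡n i j | ℕ.∸-+-assoc n i j = ℤ.*-assoc (f i) (g j) _

⊛-identityˡ : ∀ f → (oneS ⊛ f) ≗ f
⊛-identityˡ f n = trans (cong (oneS ⊛ f) (sym (ℕ.+-identityʳ n))) (qpow-⊛-+ 0 f n)

⊛-identityʳ : ∀ f → (f ⊛ oneS) ≗ f
⊛-identityʳ f n = trans (⊛-comm f oneS n) (⊛-identityˡ f n)

⊛-commutativeMonoid : CommutativeMonoid _ _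
⊛-commutativeMonoid = record
  { Carrier = Series
  ; _≈_ = _≗_
  ; _∙_ = _⊛_
  ; ε = oneS
  ; isCommutativeMonoid = record
    { isMonoid = record
      { isSemigroup = record
        { isMagma = record
          { isEquivalence = Setoid.isEquivalence (ℕ →-setoid ℤ)
          ; ∙-cong = ⊛-cong }
        ; assoc = ⊛-assoc }
      ; identity = ⊛-identityˡ , ⊛-identityʳ }
    ; comm = ⊛-comm } }

open import Algebra.Properties.CommutativeSemigroup
  (CommutativeMonoid.commutativeSemigroup ⊛-commutativeMonoid) using (interchange; x∙yz≈y∙xz)

⊛-distribˡ-⊕ : ∀ f g h → (f ⊛ (g ⊕ h)) ≗ ((f ⊛ g) ⊕ (f ⊛ h))
⊛-distribˡ-⊕ f g h n = trans
  (sumTo-cong n (λ {i} _ → ℤ.*-distribˡ-+ (f i) (g (n ∸ i)) (h (n ∸ i)))) (sumTo-distrib-+ n _ _)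

⊛-distribʳ-⊖ : ∀ f g h → ((f ⊖ g) ⊛ h) ≗ ((f ⊛ h) ⊖ (g ⊛ h))
⊛-distribʳ-⊖ f g h n = trans
  (sumTo-cong n (λ {i} _ → *-distribʳ-- (f i) (g i) (h (n ∸ i)))) (sumTo-distrib-- n _ _)
  where *-distribʳ-- : ∀ a b c → (a - b) * c ≡ a * c - b * c
        *-distribʳ-- = solve-∀

geom-+ : ∀ k j → geom k (j ℕ.+ k) ≡ geom k j
geom-+ k j = cong (if_then 1ℤ else 0ℤ) (does-⇔ (mk⇔ to from) (k ∣? (j ℕ.+ k)) (k ∣? j))
  where
  to : k ∣ j ℕ.+ k → k ∣ j
  to k∣j+k = ∣m+n∣m⇒∣n (subst (k ∣_) (ℕ.+-comm j k) k∣j+k) ∣-refl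
  from : k ∣ j → k ∣ j ℕ.+ k
  from k∣j = ∣m∣n⇒∣m+n k∣j ∣-refl

geom-+-* : ∀ k c j → geom k (j ℕ.+ c ℕ.* k) ≡ geom k j
geom-+-* k zero    j = cong (geom k) (ℕ.+-identityʳ j)
geom-+-* k (suc c) j = begin
  geom k (j ℕ.+ (k ℕ.+ c ℕ.* k)) ≡⟨ cong (geom k) (swap j k (c ℕ.* k)) ⟩
  geom k (j ℕ.+ c ℕ.* k ℕ.+ k)   ≡⟨ geom-+ k (j ℕ.+ c ℕ.* k) ⟩
  geom k (j ℕ.+ c ℕ.* k)         ≡⟨ geom-+-* k c j ⟩
  geom k j                       ∎
  where
  open ≡-Reasoning
  swap : ∀ a b c → a ℕ.+ (b ℕ.+ c) ≡ a ℕ.+ c ℕ.+ b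
  swap = ℕ-Solver.solve-∀

geom-0 : ∀ k → geom k 0 ≡ 1ℤ
geom-0 k = cong (if_then 1ℤ else 0ℤ) (dec-true (k ∣? 0) (k ∣0))

geom-< : ∀ {k m} → 0 < m → m < k → geom k m ≡ 0ℤ
geom-< {k} {suc m} _ m<k = cong (if_then 1ℤ else 0ℤ) (dec-false (k ∣? suc m) (>⇒∤ m<k))

geom-unfold : ∀ k → geom (suc k) ≗ (oneS ⊕ (qpow (suc k) ⊛ geom (suc k)))
geom-unfold k m with m <? suc k
... | yes m<k rewrite qpow-⊛-< (geom (suc k)) m<k = sym (trans (ℤ.+-identityʳ (oneS m)) (lower m m<k))
  where
  lower : ∀ m → m < suc k → oneS m ≡ geom (suc k) m
  lower zero    _   = sym (geom-0 (suc k))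
  lower (suc m) m<k = sym (geom-< (s≤s z≤n) m<k)
... | no m≮k = begin
  geom (suc k) m                                   ≡⟨ cong (geom (suc k)) m≡j+k ⟨
  geom (suc k) (j ℕ.+ suc k)                       ≡⟨ geom-+ (suc k) j ⟩
  geom (suc k) j                                   ≡⟨ qpow-⊛-+ (suc k) (geom (suc k)) j ⟨
  (qpow (suc k) ⊛ geom (suc k)) (j ℕ.+ suc k)      ≡⟨ cong (qpow (suc k) ⊛ geom (suc k)) m≡j+k ⟩
  (qpow (suc k) ⊛ geom (suc k)) m                  ≡⟨ ℤ.+-identityˡ _ ⟨
  0ℤ + (qpow (suc k) ⊛ geom (suc k)) m             ≡⟨ cong (_+ (qpow (suc k) ⊛ geom (suc k)) m) (oneS-pos 0<m) ⟨
  oneS m + (qpow (suc k) ⊛ geom (suc k)) m         ∎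
  where
  open ≡-Reasoning
  j = m ∸ suc k
  m≡j+k : j ℕ.+ suc k ≡ m
  m≡j+k = m∸n+n≡m (≮⇒≥ m≮k)
  0<m : 0 < m
  0<m = ℕ.<-≤-trans ℕ.z<s (≮⇒≥ m≮k)

qpow-⊛-geom : ∀ k → (qpow (suc k) ⊛ geom (suc k)) ≗ (geom (suc k) ⊖ oneS)
qpow-⊛-geom k n = sym (trans (cong (_- oneS n) (geom-unfold k n)) (cancel (oneS n) _))
  where cancel : ∀ a b → (a + b) - a ≡ b
        cancel = solve-∀

one-minus-qpow-⊛-geom : ∀ k → ((oneS ⊖ qpow (suc k)) ⊛ geom (suc k)) ≗ oneS
one-minus-qpow-⊛-geom k n = begin
  ((oneS ⊖ qpow (suc k)) ⊛ geom (suc k)) n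
    ≡⟨ ⊛-distribʳ-⊖ oneS (qpow (suc k)) (geom (suc k)) n ⟩
  (oneS ⊛ geom (suc k)) n - (qpow (suc k) ⊛ geom (suc k)) n
    ≡⟨ cong₂ _-_ (⊛-identityˡ (geom (suc k)) n) (qpow-⊛-geom k n) ⟩
  geom (suc k) n - (geom (suc k) n - oneS n)
    ≡⟨ cancel (geom (suc k) n) (oneS n) ⟩
  oneS n ∎
  where
  open ≡-Reasoning
  cancel : ∀ a b → a - (a - b) ≡ b
  cancel = solve-∀

⊛-geom-unfold : ∀ f k n → (f ⊛ geom (suc k)) n ≡ f n + (qpow (suc k) ⊛ (f ⊛ geom (suc k))) n
⊛-geom-unfold f k n = begin
  (f ⊛ g) n                        ≡⟨ ⊛-congʳ f (geom-unfold k) n ⟩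
  (f ⊛ (oneS ⊕ (q ⊛ g))) n         ≡⟨ ⊛-distribˡ-⊕ f oneS (q ⊛ g) n ⟩
  (f ⊛ oneS) n + (f ⊛ (q ⊛ g)) n   ≡⟨ cong₂ _+_ (⊛-identityʳ f n) (x∙yz≈y∙xz f q g n) ⟩
  f n + (q ⊛ (f ⊛ g)) n            ∎
  where
  open ≡-Reasoning
  q = qpow (suc k)
  g = geom (suc k)

⊛-geom-< : ∀ f {k m} → m < suc k → (f ⊛ geom (suc k)) m ≡ f m
⊛-geom-< f {k} {m} m<k = trans (⊛-geom-unfold f k m)
  (trans (cong (f m +_) (qpow-⊛-< (f ⊛ geom (suc k)) m<k)) (ℤ.+-identityʳ (f m)))

⊛-geom-+ : ∀ f k j → (f ⊛ geom (suc k)) (j ℕ.+ suc k) ≡ f (j ℕ.+ suc k) + (f ⊛ geom (suc k)) j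
⊛-geom-+ f k j = trans (⊛-geom-unfold f k (j ℕ.+ suc k))
  (cong (f (j ℕ.+ suc k) +_) (qpow-⊛-+ (suc k) (f ⊛ geom (suc k)) j))

⊛-geom-+-* : ∀ f k c n → (f ⊛ geom (suc k)) (n ℕ.+ suc c ℕ.* suc k)
                      ≡ sumTo c (λ j → f (n ℕ.+ suc j ℕ.* suc k)) + (f ⊛ geom (suc k)) n
⊛-geom-+-* f k zero    n rewrite ℕ.+-identityʳ k = ⊛-geom-+ f k n
⊛-geom-+-* f k (suc c) n = begin
  F (n ℕ.+ (suc k ℕ.+ suc c ℕ.* suc k))     ≡⟨ cong F step ⟩
  F (m ℕ.+ suc k)                           ≡⟨ ⊛-geom-+ f k m ⟩
  f (m ℕ.+ suc k) + F m                     ≡⟨ cong₂ _+_ (cong f (sym step)) (⊛-geom-+-* f k c n) ⟩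
  f (n ℕ.+ suc (suc c) ℕ.* suc k) + (S + F n) ≡⟨ +-rotate _ S (F n) ⟩
  (S + f (n ℕ.+ suc (suc c) ℕ.* suc k)) + F n ∎
  where
  open ≡-Reasoning
  F = f ⊛ geom (suc k)
  m = n ℕ.+ suc c ℕ.* suc k
  S = sumTo c (λ j → f (n ℕ.+ suc j ℕ.* suc k))
  step : n ℕ.+ (suc k ℕ.+ suc c ℕ.* suc k) ≡ m ℕ.+ suc k
  step = swap n (suc k) (suc c ℕ.* suc k)
    where swap : ∀ a b c → a ℕ.+ (b ℕ.+ c) ≡ a ℕ.+ c ℕ.+ b
          swap = ℕ-Solver.solve-∀
  +-rotate : ∀ a b c → a + (b + c) ≡ (b + a) + c
  +-rotate = solve-∀

nonneg-by-increments : ∀ (F D : ℕ → ℤ) T p .{{_ : NonZero p}} →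
  (∀ n → T ≤ n → F (n ℕ.+ p) ≡ D n + F n) → (∀ n → T ≤ n → 0ℤ ≤ℤ D n) →
  (∀ {i} → i < p → 0ℤ ≤ℤ F (T ℕ.+ i)) → ∀ n → T ≤ n → 0ℤ ≤ℤ F n
nonneg-by-increments F D T p step D≥0 base n T≤n =
  subst (λ m → 0ℤ ≤ℤ F m) (m+[n∸m]≡n T≤n) (<-rec (λ i → 0ℤ ≤ℤ F (T ℕ.+ i)) go (n ∸ T))
  where
  go : ∀ i → (∀ {j} → j < i → 0ℤ ≤ℤ F (T ℕ.+ j)) → 0ℤ ≤ℤ F (T ℕ.+ i)
  go i ih with i <? p
  ... | yes i<p = base i<p
  ... | no  i≮p = subst (λ m → 0ℤ ≤ℤ F m) T+j+p≡T+i
    (subst (0ℤ ≤ℤ_) (sym (step (T ℕ.+ j) (m≤m+n T j)))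
      (ℤ.+-mono-≤ (D≥0 (T ℕ.+ j) (m≤m+n T j)) (ih j<i)))
    where
    j = i ∸ p
    j+p≡i : j ℕ.+ p ≡ i
    j+p≡i = m∸n+n≡m (≮⇒≥ i≮p)
    T+j+p≡T+i : T ℕ.+ j ℕ.+ p ≡ T ℕ.+ i
    T+j+p≡T+i = trans (ℕ.+-assoc T j p) (cong (T ℕ.+_) j+p≡i)
    j<i : j < i
    j<i = subst (j <_) j+p≡i (m<m+n j (ℕ.>-nonZero⁻¹ p))

⊛-geom-nonneg : ∀ f k T → (∀ n → T ≤ n → 0ℤ ≤ℤ f n) →
  (∀ {i} → i < suc k → 0ℤ ≤ℤ (f ⊛ geom (suc k)) (T ℕ.+ i)) →
  ∀ n → T ≤ n → 0ℤ ≤ℤ (f ⊛ geom (suc k)) n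
⊛-geom-nonneg f k T f≥0 = nonneg-by-increments (f ⊛ geom (suc k)) (λ n → f (n ℕ.+ suc k)) T (suc k)
  (λ n _ → ⊛-geom-+ f k n) (λ n T≤n → f≥0 (n ℕ.+ suc k) (≤-trans T≤n (m≤m+n n (suc k))))

-- The coefficient f n + f (n ∸ k) + f (n ∸ 2k) + ⋯ of qⁿ in f/(1 - qᵏ), computed without
-- convolution; it is exact once the fuel (third argument) is at least n.
strideSum : ℕ → Series → ℕ → ℕ → ℤ
strideSum k f zero       n = f n
strideSum k f (suc fuel) n with k ≤? n
... | yes _ = f n + strideSum k f fuel (n ∸ k)
... | no  _ = f n

evalGeom : ℕ → Series → Series
evalGeom k f n = strideSum k f n n

⊛-geom≗strideSum : ∀ {f f′} k → f ≗ f′ → ∀ fuel {n} → n ≤ fuel →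
  (f ⊛ geom (suc k)) n ≡ strideSum (suc k) f′ fuel n
⊛-geom≗strideSum {f} k f≗f′ zero z≤n = trans (⊛-geom-< f {k} ℕ.z<s) (f≗f′ 0)
⊛-geom≗strideSum {f} {f′} k f≗f′ (suc fuel) {n} n≤1+fuel with suc k ≤? n
... | no  k≮n = trans (⊛-geom-< f (ℕ.≰⇒> k≮n)) (f≗f′ n)
... | yes k<n = begin
  (f ⊛ geom (suc k)) n                      ≡⟨ cong (f ⊛ geom (suc k)) j+k≡n ⟨
  (f ⊛ geom (suc k)) (j ℕ.+ suc k)          ≡⟨ ⊛-geom-+ f k j ⟩
  f (j ℕ.+ suc k) + (f ⊛ geom (suc k)) j    ≡⟨ cong₂ _+_ (trans (cong f j+k≡n) (f≗f′ n))
                                                         (⊛-geom≗strideSum k f≗f′ fuel j≤fuel) ⟩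
  f′ n + strideSum (suc k) f′ fuel j        ∎
  where
  open ≡-Reasoning
  j = n ∸ suc k
  j+k≡n : j ℕ.+ suc k ≡ n
  j+k≡n = m∸n+n≡m k<n
  j≤fuel : j ≤ fuel
  j≤fuel = ℕ.m<1+n⇒m≤n (ℕ.<-≤-trans (subst (j <_) j+k≡n (m<m+n j ℕ.z<s)) n≤1+fuel)

⊛-geom≗evalGeom : ∀ {f f′} k → f ≗ f′ → (f ⊛ geom (suc k)) ≗ evalGeom (suc k) f′
⊛-geom≗evalGeom k f≗f′ n = ⊛-geom≗strideSum k f≗f′ n ≤-refl

nonneg-checked : ∀ {F E : Series} → F ≗ E → ∀ T p → True (allUpTo? (λ i → 0ℤ ℤ.≤? E (T ℕ.+ i)) p) →
  ∀ {i} → i < p → 0ℤ ≤ℤ F (T ℕ.+ i)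
nonneg-checked {F} {E} F≗E T p check i<p =
  subst (0ℤ ≤ℤ_) (sym (F≗E (T ℕ.+ _))) (toWitness check i<p)

module ≗-Reasoning = SetoidReasoning (ℕ →-setoid ℤ)

invPoch-suc : ∀ s m → invPoch s (suc m) ≗ (geom s ⊛ invPoch (suc s) m)
invPoch-suc s zero n = begin
  (oneS ⊛ geom (s ℕ.+ 0)) n  ≡⟨ ⊛-identityˡ (geom (s ℕ.+ 0)) n ⟩
  geom (s ℕ.+ 0) n           ≡⟨ cong (λ t → geom t n) (ℕ.+-identityʳ s) ⟩
  geom s n                   ≡⟨ ⊛-identityʳ (geom s) n ⟨
  (geom s ⊛ oneS) n          ∎
  where open ≡-Reasoning
invPoch-suc s (suc m) = begin
  invPoch s (suc m) ⊛ geom (s ℕ.+ suc m)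
    ≈⟨ ⊛-congˡ (geom (s ℕ.+ suc m)) (invPoch-suc s m) ⟩
  (geom s ⊛ invPoch (suc s) m) ⊛ geom (s ℕ.+ suc m)
    ≈⟨ ⊛-assoc (geom s) (invPoch (suc s) m) (geom (s ℕ.+ suc m)) ⟩
  geom s ⊛ (invPoch (suc s) m ⊛ geom (s ℕ.+ suc m))
    ≡⟨ cong (λ t → geom s ⊛ (invPoch (suc s) m ⊛ geom t)) (ℕ.+-suc s m) ⟩
  geom s ⊛ invPoch (suc s) (suc m) ∎
  where open ≗-Reasoning

⊛-invPoch-suc : ∀ f s m → (f ⊛ invPoch s (suc m)) ≗ ((f ⊛ invPoch s m) ⊛ geom (s ℕ.+ m))
⊛-invPoch-suc f s m n = sym (⊛-assoc f (invPoch s m) (geom (s ℕ.+ m)) n)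

u : Series
u = (geom 3 ⊖ oneS) ⊖ geom 5

W : Series
W = geom 4 ⊛ invPoch 6 3

invPoch-4-5 : invPoch 4 5 ≗ (geom 5 ⊛ W)
invPoch-4-5 = begin
  invPoch 4 5                          ≈⟨ invPoch-suc 4 4 ⟩
  geom 4 ⊛ invPoch 5 4                 ≈⟨ ⊛-congʳ (geom 4) (invPoch-suc 5 3) ⟩
  geom 4 ⊛ (geom 5 ⊛ invPoch 6 3)      ≈⟨ x∙yz≈y∙xz (geom 4) (geom 5) (invPoch 6 3) ⟩
  geom 5 ⊛ W                           ∎
  where open ≗-Reasoning

leading-term : ((qpow 3 ⊛ (oneS ⊖ qpow 5)) ⊛ invPoch 3 6) ≗ ((geom 3 ⊖ oneS) ⊛ W)
leading-term = begin
  (qpow 3 ⊛ c) ⊛ invPoch 3 6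
    ≈⟨ ⊛-congʳ (qpow 3 ⊛ c) (invPoch-suc 3 5) ⟩
  (qpow 3 ⊛ c) ⊛ (geom 3 ⊛ invPoch 4 5)
    ≈⟨ ⊛-congʳ (qpow 3 ⊛ c) (⊛-congʳ (geom 3) invPoch-4-5) ⟩
  (qpow 3 ⊛ c) ⊛ (geom 3 ⊛ (geom 5 ⊛ W))
    ≈⟨ interchange (qpow 3) c (geom 3) (geom 5 ⊛ W) ⟩
  (qpow 3 ⊛ geom 3) ⊛ (c ⊛ (geom 5 ⊛ W))
    ≈⟨ ⊛-congʳ (qpow 3 ⊛ geom 3) (⊛-assoc c (geom 5) W) ⟨
  (qpow 3 ⊛ geom 3) ⊛ ((c ⊛ geom 5) ⊛ W)
    ≈⟨ ⊛-congʳ (qpow 3 ⊛ geom 3) (⊛-congˡ W (one-minus-qpow-⊛-geom 4)) ⟩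
  (qpow 3 ⊛ geom 3) ⊛ (oneS ⊛ W)
    ≈⟨ ⊛-cong (qpow-⊛-geom 2) (⊛-identityˡ W) ⟩
  (geom 3 ⊖ oneS) ⊛ W ∎
  where
  open ≗-Reasoning
  c = oneS ⊖ qpow 5

H-5-3-5 : H 5 3 5 ≗ (oneS ⊕ (u ⊛ W))
H-5-3-5 n = begin
  H 5 3 5 n
    ≡⟨ cong₂ _-_ (leading-term n) (cong (_- oneS n) (invPoch-4-5 n)) ⟩
  ((geom 3 ⊖ oneS) ⊛ W) n - ((geom 5 ⊛ W) n - oneS n)
    ≡⟨ rearrange (((geom 3 ⊖ oneS) ⊛ W) n) ((geom 5 ⊛ W) n) (oneS n) ⟩
  oneS n + (((geom 3 ⊖ oneS) ⊛ W) n - (geom 5 ⊛ W) n)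
    ≡⟨ cong (oneS n +_) (⊛-distribʳ-⊖ (geom 3 ⊖ oneS) (geom 5) W n) ⟨
  oneS n + (u ⊛ W) n ∎
  where
  open ≡-Reasoning
  rearrange : ∀ a b c → a - (b - c) ≡ c + (a - b)
  rearrange = solve-∀

u₄ u₄₆ u₄₆₇ u₄₆₇₈ : Series
u₄    = u ⊛ geom 4
u₄₆   = u₄ ⊛ geom 6
u₄₆₇  = u₄₆ ⊛ geom 7
u₄₆₇₈ = u₄₆₇ ⊛ geom 8

u₄-eval : u₄ ≗ evalGeom 4 u
u₄-eval = ⊛-geom≗evalGeom 3 (λ _ → refl)

u₄₆-eval : u₄₆ ≗ evalGeom 6 (evalGeom 4 u)
u₄₆-eval = ⊛-geom≗evalGeom 5 u₄-eval

u₄₆₇-eval : u₄₆₇ ≗ evalGeom 7 (evalGeom 6 (evalGeom 4 u))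
u₄₆₇-eval = ⊛-geom≗evalGeom 6 u₄₆-eval

u₄₆₇₈-eval : u₄₆₇₈ ≗ evalGeom 8 (evalGeom 7 (evalGeom 6 (evalGeom 4 u)))
u₄₆₇₈-eval = ⊛-geom≗evalGeom 7 u₄₆₇-eval

u⊛W≗u₄₆₇₈ : (u ⊛ W) ≗ u₄₆₇₈
u⊛W≗u₄₆₇₈ = begin
  u ⊛ (geom 4 ⊛ invPoch 6 3)
    ≈⟨ ⊛-assoc u (geom 4) (invPoch 6 3) ⟨
  u₄ ⊛ invPoch 6 3
    ≈⟨ ⊛-invPoch-suc u₄ 6 2 ⟩
  (u₄ ⊛ invPoch 6 2) ⊛ geom 8
    ≈⟨ ⊛-congˡ (geom 8) (⊛-invPoch-suc u₄ 6 1) ⟩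
  ((u₄ ⊛ invPoch 6 1) ⊛ geom 7) ⊛ geom 8
    ≈⟨ ⊛-congˡ (geom 8) (⊛-congˡ (geom 7) (⊛-invPoch-suc u₄ 6 0)) ⟩
  (((u₄ ⊛ oneS) ⊛ geom 6) ⊛ geom 7) ⊛ geom 8
    ≈⟨ ⊛-congˡ (geom 8) (⊛-congˡ (geom 7) (⊛-congˡ (geom 6) (⊛-identityʳ u₄))) ⟩
  u₄₆₇₈ ∎
  where open ≗-Reasoning

u-+15 : ∀ {x} → 0 < x → u (x ℕ.+ 15) ≡ u x
u-+15 {x} 0<x = cong₂ _-_ (cong₂ _-_ (geom-+-* 3 5 x) oneS-+15) (geom-+-* 5 3 x)
  where oneS-+15 : oneS (x ℕ.+ 15) ≡ oneS x
        oneS-+15 = trans (oneS-pos (ℕ.<-≤-trans 0<x (m≤m+n x 15))) (sym (oneS-pos 0<x))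

-- The increment u₄ (n + 60) - u₄ n, over 60 = lcm(4, 15) steps.
window : ℕ → ℤ
window n = sumTo 14 (λ j → u (n ℕ.+ suc j ℕ.* 4))

window-+15 : ∀ n → window (n ℕ.+ 15) ≡ window n
window-+15 n = sumTo-cong 14 λ {j} _ →
  trans (cong u (swap n 15 (suc j ℕ.* 4))) (u-+15 (ℕ.<-≤-trans ℕ.z<s (m≤n+m (suc j ℕ.* 4) n)))
  where swap : ∀ a b c → a ℕ.+ b ℕ.+ c ≡ a ℕ.+ c ℕ.+ b
        swap = ℕ-Solver.solve-∀

window-nonneg : ∀ n → 0ℤ ≤ℤ window n
window-nonneg n = nonneg-by-increments window (λ _ → 0ℤ) 0 15
  (λ n _ → trans (window-+15 n) (sym (ℤ.+-identityˡ (window n)))) (λ _ _ → ℤ.≤-refl)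
  (nonneg-checked {window} (λ _ → refl) 0 15 _) n z≤n

u₄-nonneg : ∀ n → 40 ≤ n → 0ℤ ≤ℤ u₄ n
u₄-nonneg = nonneg-by-increments u₄ window 40 60 (λ n _ → ⊛-geom-+-* u 3 14 n) (λ n _ → window-nonneg n)
  (nonneg-checked u₄-eval 40 60 _)

u₄₆-nonneg : ∀ n → 40 ≤ n → 0ℤ ≤ℤ u₄₆ n
u₄₆-nonneg = ⊛-geom-nonneg u₄ 5 40 u₄-nonneg (nonneg-checked u₄₆-eval 40 6 _)

u₄₆₇-nonneg : ∀ n → 40 ≤ n → 0ℤ ≤ℤ u₄₆₇ n
u₄₆₇-nonneg = ⊛-geom-nonneg u₄₆ 6 40 u₄₆-nonneg (nonneg-checked u₄₆₇-eval 40 7 _)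

u₄₆₇₈-nonneg : ∀ n → 40 ≤ n → 0ℤ ≤ℤ u₄₆₇₈ n
u₄₆₇₈-nonneg = ⊛-geom-nonneg u₄₆₇ 7 40 u₄₆₇-nonneg (nonneg-checked u₄₆₇₈-eval 40 8 _)

lemma18 : (N : ℕ) → 164 ≤ N → 0ℤ ≤ℤ H 5 3 5 N
lemma18 N 164≤N = subst (0ℤ ≤ℤ_) (sym H≡u₄₆₇₈)
  (u₄₆₇₈-nonneg N (≤-trans (m≤m+n 40 124) 164≤N))
  where
  H≡u₄₆₇₈ : H 5 3 5 N ≡ u₄₆₇₈ N
  H≡u₄₆₇₈ = begin
    H 5 3 5 N            ≡⟨ H-5-3-5 N ⟩
    oneS N + (u ⊛ W) N   ≡⟨ cong₂ _+_ (oneS-pos (ℕ.<-≤-trans ℕ.z<s 164≤N)) (u⊛W≗u₄₆₇₈ N) ⟩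
    0ℤ + u₄₆₇₈ N         ≡⟨ ℤ.+-identityˡ (u₄₆₇₈ N) ⟩
    u₄₆₇₈ N              ∎
    where open ≡-Reasoning
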